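{- Let $X$ be a finite metric space, $a_0\in X$, $P\subseteq\mathcal{P}_X$ with $P=P^{ -1}$ and $X\setminus\{a_0\}\subseteq P(a_0)$. Let $(Y,\phi)$ be a $P$-type S-extension of $X$. Then there is a map $\pi:\Gamma\to Y$ such that $d_Y(\pi(g_1H),\pi(g_2H))=w(g_1H,g_2H)$ whenever $(g_1H,g_2H)$ is an edge of $\Gamma$.
   Context: A partial isometry of $X$ is an isometry between finite subsets of $X$; $\mathcal{P}_X$ is the set of those not contained in the identity; $P(a_0)=\{p(a_0):p\in P,\ a_0\in\mathrm{dom}(p)\}$. A $P$-type S-extension of $X$ is $(Y,\phi)$ with $Y$ a metric space extending $X$ and $\phi:P\to\mathrm{Iso}(Y)$ with $\phi(p)\restriction\mathrm{dom}(p)=p$ for all $p\in P$. $\mathbb{F}(P)$ is the free group on $P$ with $p^{ -1}\in P$ identified with the formal inverse of $p$. $H\le\mathbb{F}(P)$ is the subgroup of elements represented by words $p_1\cdots p_n$ ($p_i\in P$) such that $p_1(p_2(\cdots p_n(a_0)\cdots))$ is defined and equals $a_0$. $\Gamma=\{gH:g\in\mathbb{F}(P)\}$ is the set of left cosets, made into a weighted graph $(\Gamma,w)$ with an edge between $gpH$ and $gqH$ (when distinct) for every $g\in\mathbb{F}(P)$ and $p,q\in P\cup\{1\}$ with $p(a_0),q(a_0)$ defined, of weight $w(gpH,gqH)=d_X(p(a_0),q(a_0))$ (this is well defined). -}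

module Defs where

open import Data.Nat using (ℕ)
open import Data.Fin using (Fin)
open import Data.Vec using (Vec; lookup)
open import Data.Maybe using (Maybe; just; nothing; _>>=_)
open import Data.Bool using (Bool; T)
open import Data.List using (List; []; _∷_; _++_)
open import Data.Product using (Σ; ∃; _×_; _,_; proj₁)
open import Relation.Binary.Core using (Rel)
import Level
open import Relation.Binary.PropositionalEquality using (_≡_; _≢_)
open import Relation.Binary.Construct.Closure.Equivalence using (EqClosure)

PMap : ℕ → Set
PMap n = Vec (Maybe (Fin n)) n

module _ {n : ℕ} {D : Set} (d : Fin n → Fin n → D) where

  -- p is a partial isometry of (X,d): an isometry between finite subsets of X
  -- (injectivity on the domain follows from the metric axioms).
  IsPartialIsometry : PMap n → Set
  IsPartialIsometry p = ∀ x y x' y' → lookup p x ≡ just y → lookup p x' ≡ just y' →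
                        d y y' ≡ d x x'

-- p is not contained in the identity (p ∈ 𝒫_X requires this)
NotInIdentity : {n : ℕ} → PMap n → Set
NotInIdentity p = ∃ λ x → ∃ λ y → lookup p x ≡ just y × y ≢ x

IsInverse : {n : ℕ} → PMap n → PMap n → Set
IsInverse p q = ∀ x y → (lookup p x ≡ just y → lookup q y ≡ just x)
                      × (lookup q y ≡ just x → lookup p x ≡ just y)

module _ {n : ℕ} (P : PMap n → Bool) where

  Gen : Set
  Gen = Σ (PMap n) (λ p → T (P p))

  Word : Set
  Word = List Gen

  -- evaluation: the word p₁ ⋯ pₙ applied to x is p₁(p₂(⋯ pₙ(x)⋯)) (if defined)
  eval : Word → Fin n → Maybe (Fin n)
  eval [] x = just x
  eval (p ∷ w) x = eval w x >>= λ y → lookup (proj₁ p) y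

  -- one free-reduction step: u p p⁻¹ v ↦ u v  (p⁻¹ ∈ P identified with the formal inverse of p)
  data Cancel : Rel Word Level.zero where
    cancel : (u v : Word) (p q : Gen) → IsInverse (proj₁ p) (proj₁ q) →
             Cancel (u ++ p ∷ q ∷ v) (u ++ v)

  _≈F_ : Rel Word Level.zero
  _≈F_ = EqClosure Cancel

  -- elements of P ∪ {1}: nothing stands for the identity 1
  -- g · p  is the word g p (g · 1 = g)
  _·_ : Word → Maybe Gen → Word
  g · nothing = g
  g · just p = g ++ (p ∷ [])

  apply : Maybe Gen → Fin n → Maybe (Fin n)
  apply nothing x = just x
  apply (just p) x = lookup (proj₁ p) x

  module _ (a₀ : Fin n) where

    InH : Word → Set
    InH g = ∃ λ w → w ≈F g × eval w a₀ ≡ just a₀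

    SameCoset : Word → Word → Set
    SameCoset g g' = ∃ λ h → InH h × g' ≈F (g ++ h)

-- The map φ(p⁻¹) need not be φ(p)⁻¹, so letting words act on Y letter by letter is not
-- well defined on 𝔽(P). Instead π(g) applies the letters of the free reduction of g to ι(a₀).
-- Appending a word s with s(a) = z to g and reducing cancels only letters whose partial maps undo
-- each other on the points involved, so reduce(g s) sends ι(a) where reduce(g) sends ι(z).
-- Taking s ∈ H gives invariance on cosets.
module Submission where

open import Defs
open import Level using (0ℓ)
open import Data.Nat using (ℕ)
open import Data.Fin using (Fin; _≟_)
open import Data.Fin.Properties using (all?)
open import Data.Vec using (lookup; tabulate)
open import Data.Vec.Properties using (tabulate∘lookup; tabulate-cong)
open import Data.Maybe using (Maybe; just; nothing; _>>=_)
open import Data.Maybe.Properties using (just-injective) renaming (≡-dec to Maybe-≡-dec)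
open import Data.Bool using (Bool; T)
open import Data.Bool.Properties using (T-irrelevant)
open import Data.List using (List; []; _∷_; _++_; foldr)
open import Data.List.Properties using (foldr-++)
open import Data.Product using (Σ; ∃; _×_; _,_; proj₁; proj₂; swap)
open import Algebra.Core using (Op₂)
open import Relation.Binary.Core using (Rel)
open import Relation.Binary.Definitions using (DecidableEquality)
open import Relation.Binary.Construct.Closure.Symmetric using (fwd; bwd)
open import Relation.Binary.Construct.Closure.ReflexiveTransitive using (ε; _◅_)
open import Relation.Nullary using (¬_; Dec; yes; no; contradiction)
open import Relation.Nullary.Decidable using (map′; _×-dec_; _→-dec_)
open import Relation.Binary.PropositionalEquality using (_≡_; _≢_; refl; sym; trans; cong; cong₂; module ≡-Reasoning)
open import Function.Metric.Structures using (IsGeneralMetric)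

maybe-ext : {A : Set} {a b : Maybe A} →
            (∀ {x} → a ≡ just x → b ≡ just x) → (∀ {x} → b ≡ just x → a ≡ just x) → a ≡ b
maybe-ext {a = just x}  a⇒b _   = sym (a⇒b refl)
maybe-ext {a = nothing} {just y}  _ b⇒a = b⇒a refl
maybe-ext {a = nothing} {nothing} _ _   = refl

>>=-just : {A B : Set} {m : Maybe A} {f : A → Maybe B} {z : B} →
           (m >>= f) ≡ just z → ∃ λ y → m ≡ just y × f y ≡ just z
>>=-just {m = just y} fy≡z = y , refl , fy≡z

module WordAction {A Y : Set} (φ : A → Y → Y) where

  ⟦_⟧ : List A → Y → Y
  ⟦ [] ⟧    y = y
  ⟦ a ∷ w ⟧ y = φ a (⟦ w ⟧ y)

  ⟦⟧-++ : ∀ u v y → ⟦ u ++ v ⟧ y ≡ ⟦ u ⟧ (⟦ v ⟧ y)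
  ⟦⟧-++ []      v y = refl
  ⟦⟧-++ (a ∷ u) v y = cong (φ a) (⟦⟧-++ u v y)

  ⟦⟧-isometry : {D : Set} (d : Y → Y → D) → (∀ a y y' → d (φ a y) (φ a y') ≡ d y y') →
                ∀ w y y' → d (⟦ w ⟧ y) (⟦ w ⟧ y') ≡ d y y'
  ⟦⟧-isometry d φ-iso []      y y' = refl
  ⟦⟧-isometry d φ-iso (a ∷ w) y y' = trans (φ-iso a _ _) (⟦⟧-isometry d φ-iso w y y')

module FreeReduction {n : ℕ} (P : PMap n → Bool) where

  record Inverse (p q : Gen P) : Set where
    constructor inverse
    field isInverse : IsInverse (proj₁ p) (proj₁ q)
  open Inverse

  opaque
    inverse? : ∀ p q → Dec (Inverse p q)
    inverse? (p , _) (q , _) = map′ inverse isInverse (all? λ x → all? λ y →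
      (lookup p x ≟ₘ just y →-dec lookup q y ≟ₘ just x) ×-dec
      (lookup q y ≟ₘ just x →-dec lookup p x ≟ₘ just y))
      where
        _≟ₘ_ : DecidableEquality (Maybe (Fin n))
        _≟ₘ_ = Maybe-≡-dec _≟_

  inverse-sym : ∀ {p q} → Inverse p q → Inverse q p
  inverse-sym (inverse p⁻¹≡q) = inverse λ x y → swap (p⁻¹≡q y x)

  inverse-lookup : ∀ {p q x y} → Inverse p q → lookup (proj₁ q) y ≡ just x → lookup (proj₁ p) x ≡ just y
  inverse-lookup (inverse p⁻¹≡q) = proj₂ (p⁻¹≡q _ _)

  Gen-≡ : ∀ {p q : Gen P} → proj₁ p ≡ proj₁ q → p ≡ q
  Gen-≡ {p , Tp} {.p , Tq} refl = cong (p ,_) (T-irrelevant Tp Tq)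

  inverse-unique : ∀ {p q q'} → Inverse p q → Inverse p q' → q ≡ q'
  inverse-unique {p} {q} {q'} p⁻¹≡q p⁻¹≡q' = Gen-≡ (begin
    proj₁ q                      ≡⟨ tabulate∘lookup (proj₁ q) ⟨
    tabulate (lookup (proj₁ q))  ≡⟨ tabulate-cong lookups-agree ⟩
    tabulate (lookup (proj₁ q')) ≡⟨ tabulate∘lookup (proj₁ q') ⟩
    proj₁ q'                     ∎)
    where
      open ≡-Reasoning
      lookups-agree : ∀ y → lookup (proj₁ q) y ≡ lookup (proj₁ q') y
      lookups-agree y = maybe-ext
        (λ qy≡x → proj₁ (isInverse p⁻¹≡q' _ y) (inverse-lookup p⁻¹≡q qy≡x))
        (λ q'y≡x → proj₁ (isInverse p⁻¹≡q _ y) (inverse-lookup p⁻¹≡q' q'y≡x))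

  push : Gen P → Word P → Word P
  push p []      = p ∷ []
  push p (q ∷ w) with inverse? p q
  ... | yes _ = w
  ... | no  _ = p ∷ q ∷ w

  pushAll : Word P → Word P → Word P
  pushAll u w = foldr push w u

  reduce : Word P → Word P
  reduce w = pushAll w []

  reduce-++ : ∀ u v → reduce (u ++ v) ≡ pushAll u (reduce v)
  reduce-++ u v = foldr-++ push [] u v

  push-cancels : ∀ {p q w} → Inverse p q → push p (q ∷ w) ≡ w
  push-cancels {p} {q} p⁻¹≡q with inverse? p q
  ... | yes _  = refl
  ... | no  ¬i = contradiction p⁻¹≡q ¬i

  push-conses : ∀ {p q w} → ¬ Inverse p q → push p (q ∷ w) ≡ p ∷ q ∷ w
  push-conses {p} {q} ¬i with inverse? p q
  ... | yes i = contradiction i ¬i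
  ... | no  _ = refl

  data PushView (p : Gen P) : Word P → Set where
    cancels : ∀ {q w} → Inverse p q → push p (q ∷ w) ≡ w → PushView p (q ∷ w)
    conses  : ∀ {w} → push p w ≡ p ∷ w → PushView p w

  pushView : ∀ p w → PushView p w
  pushView p []      = conses refl
  pushView p (q ∷ w) with inverse? p q
  ... | yes p⁻¹≡q = cancels p⁻¹≡q (push-cancels p⁻¹≡q)
  ... | no  ¬i    = conses (push-conses ¬i)

  data Reduced : Word P → Set where
    nil  : Reduced []
    sing : ∀ p → Reduced (p ∷ [])
    cons : ∀ {p q w} → ¬ Inverse p q → Reduced (q ∷ w) → Reduced (p ∷ q ∷ w)

  reduced-tail : ∀ {p w} → Reduced (p ∷ w) → Reduced w
  reduced-tail (sing _)   = nil
  reduced-tail (cons _ r) = r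

  push-reduced : ∀ p {w} → Reduced w → Reduced (push p w)
  push-reduced p nil = sing p
  push-reduced p {q ∷ w} r with inverse? p q
  ... | yes _  = reduced-tail r
  ... | no  ¬i = cons ¬i r

  reduce-reduced : ∀ w → Reduced (reduce w)
  reduce-reduced []      = nil
  reduce-reduced (p ∷ w) = push-reduced p (reduce-reduced w)

  push-head-of-reduced : ∀ {q w} → Reduced (q ∷ w) → push q w ≡ q ∷ w
  push-head-of-reduced (sing _) = refl
  push-head-of-reduced (cons ¬i _) = push-conses ¬i

  push-push-inverse : ∀ {p q w} → Inverse p q → Reduced w → push p (push q w) ≡ w
  push-push-inverse {p} {q} {w} p⁻¹≡q r with pushView q w
  ... | cancels q⁻¹≡r e rewrite e | inverse-unique (inverse-sym p⁻¹≡q) q⁻¹≡r = push-head-of-reduced r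
  ... | conses e rewrite e = push-cancels p⁻¹≡q

  reduce-cancel : ∀ {w w'} → Cancel P w w' → reduce w ≡ reduce w'
  reduce-cancel (cancel u v p q p⁻¹≡q) = begin
    reduce (u ++ p ∷ q ∷ v)                   ≡⟨ reduce-++ u (p ∷ q ∷ v) ⟩
    pushAll u (push p (push q (reduce v)))    ≡⟨ cong (pushAll u) (push-push-inverse (inverse p⁻¹≡q) (reduce-reduced v)) ⟩
    pushAll u (reduce v)                      ≡⟨ reduce-++ u v ⟨
    reduce (u ++ v)                           ∎
    where open ≡-Reasoning

  ≈F⇒reduce≡ : ∀ {w w'} → _≈F_ P w w' → reduce w ≡ reduce w'
  ≈F⇒reduce≡ ε             = refl
  ≈F⇒reduce≡ (fwd c ◅ w≈w') = trans (reduce-cancel c) (≈F⇒reduce≡ w≈w')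
  ≈F⇒reduce≡ (bwd c ◅ w≈w') = trans (sym (reduce-cancel c)) (≈F⇒reduce≡ w≈w')

  reduce-++-congʳ : ∀ g {w w'} → _≈F_ P w w' → reduce (g ++ w) ≡ reduce (g ++ w')
  reduce-++-congʳ g {w} {w'} w≈w' = begin
    reduce (g ++ w)        ≡⟨ reduce-++ g w ⟩
    pushAll g (reduce w)   ≡⟨ cong (pushAll g) (≈F⇒reduce≡ w≈w') ⟩
    pushAll g (reduce w')  ≡⟨ reduce-++ g w' ⟨
    reduce (g ++ w')       ∎
    where open ≡-Reasoning

  eval-∷ : ∀ p w {x m z} → eval P w x ≡ just m → lookup (proj₁ p) m ≡ just z → eval P (p ∷ w) x ≡ just z
  eval-∷ p w wx≡m pm≡z = trans (cong (_>>= lookup (proj₁ p)) wx≡m) pm≡z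

  push-eval : ∀ p w {x m z} → eval P w x ≡ just m → lookup (proj₁ p) m ≡ just z → eval P (push p w) x ≡ just z
  push-eval p w wx≡m pm≡z with pushView p w
  ... | conses e rewrite e = eval-∷ p w wx≡m pm≡z
  ... | cancels p⁻¹≡q e rewrite e with >>=-just wx≡m
  ...   | k , w'x≡k , qk≡m = trans w'x≡k (cong just (just-injective (trans (sym (inverse-lookup p⁻¹≡q qk≡m)) pm≡z)))

  reduce-eval : ∀ w {x z} → eval P w x ≡ just z → eval P (reduce w) x ≡ just z
  reduce-eval []      wx≡z = wx≡z
  reduce-eval (p ∷ w) pwx≡z with >>=-just {m = eval P w _} pwx≡z
  ... | m , wx≡m , pm≡z = push-eval p (reduce w) (reduce-eval w wx≡m) pm≡z

  -- Invariant of pushing a letter onto both words: a cancellation eats one letter of a tail, and since the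
  -- eaten letters of both tails are inverse to the same letter, evaluation still meets at a common point.
  record Joined (a z : Fin n) (A B : Word P) : Set where
    constructor joined
    field
      prefix left right : Word P
      meet              : Fin n
      A≡prefix++left    : A ≡ prefix ++ left
      B≡prefix++right   : B ≡ prefix ++ right
      left-meets        : eval P left z ≡ just meet
      right-meets       : eval P right a ≡ just meet

  push-tails-joined : ∀ p v t {a z m} → eval P v z ≡ just m → eval P t a ≡ just m →
                      Joined a z (push p v) (push p t)
  push-tails-joined p v t vz≡m ta≡m with pushView p v | pushView p t
  ... | cancels {_} {v'} i e | cancels {_} {t'} j e'
    with >>=-just {m = eval P v' _} vz≡m | >>=-just {m = eval P t' _} ta≡m
  ...   | k , v'z≡k , hk≡m | k' , t'a≡k' , h'k'≡m = joined [] v' t' k e e' v'z≡k (trans t'a≡k' (cong just k'≡k))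
    where k'≡k = just-injective (trans (sym (inverse-lookup j h'k'≡m)) (inverse-lookup i hk≡m))
  push-tails-joined p v t vz≡m ta≡m | cancels {_} {v'} i e | conses e' with >>=-just {m = eval P v' _} vz≡m
  ...   | k , v'z≡k , hk≡m = joined [] v' (p ∷ t) k e e' v'z≡k (eval-∷ p t ta≡m (inverse-lookup i hk≡m))
  push-tails-joined p v t vz≡m ta≡m | conses e | cancels {_} {t'} j e' with >>=-just {m = eval P t' _} ta≡m
  ...   | k , t'a≡k , hk≡m = joined [] (p ∷ v) t' k e e' (eval-∷ p v vz≡m (inverse-lookup j hk≡m)) t'a≡k
  push-tails-joined p v t {m = m} vz≡m ta≡m | conses e | conses e' = joined (p ∷ []) v t m e e' vz≡m ta≡m

  push-joined : ∀ p {a z A B} → Joined a z A B → Joined a z (push p A) (push p B)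
  push-joined p (joined []      v t m refl refl vz≡m ta≡m) = push-tails-joined p v t vz≡m ta≡m
  push-joined p (joined (q ∷ u) v t m refl refl vz≡m ta≡m) with inverse? p q
  ... | yes _ = joined u v t m refl refl vz≡m ta≡m
  ... | no  _ = joined (p ∷ q ∷ u) v t m refl refl vz≡m ta≡m

  pushAll-joined : ∀ {s a z} → eval P s a ≡ just z → ∀ g → Joined a z (reduce g) (pushAll g s)
  pushAll-joined {s} {z = z} sa≡z []      = joined [] [] s z refl refl refl sa≡z
  pushAll-joined            sa≡z (p ∷ g) = push-joined p (pushAll-joined sa≡z g)

module ExtensionAction {n : ℕ} (P : PMap n → Bool) {Y : Set} (ι : Fin n → Y) (φ : Gen P → Y → Y)
         (φ-extends : ∀ p x y → lookup (proj₁ p) x ≡ just y → φ p (ι x) ≡ ι y) where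

  open FreeReduction P
  open WordAction φ

  ⟦⟧-eval : ∀ w {x z} → eval P w x ≡ just z → ⟦ w ⟧ (ι x) ≡ ι z
  ⟦⟧-eval []      refl = refl
  ⟦⟧-eval (p ∷ w) pwx≡z with >>=-just {m = eval P w _} pwx≡z
  ... | m , wx≡m , pm≡z = trans (cong (φ p) (⟦⟧-eval w wx≡m)) (φ-extends p m _ pm≡z)

  ⟦⟧-joined : ∀ {a z A B} → Joined a z A B → ⟦ B ⟧ (ι a) ≡ ⟦ A ⟧ (ι z)
  ⟦⟧-joined {a} {z} (joined u v t m refl refl vz≡m ta≡m) = begin
    ⟦ u ++ t ⟧ (ι a)    ≡⟨ ⟦⟧-++ u t (ι a) ⟩
    ⟦ u ⟧ (⟦ t ⟧ (ι a)) ≡⟨ cong ⟦ u ⟧ (⟦⟧-eval t ta≡m) ⟩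
    ⟦ u ⟧ (ι m)         ≡⟨ cong ⟦ u ⟧ (⟦⟧-eval v vz≡m) ⟨
    ⟦ u ⟧ (⟦ v ⟧ (ι z)) ≡⟨ ⟦⟧-++ u v (ι z) ⟨
    ⟦ u ++ v ⟧ (ι z)    ∎
    where open ≡-Reasoning

  ⟦reduce-++⟧ : ∀ g s {a z} → eval P s a ≡ just z → ⟦ reduce (g ++ s) ⟧ (ι a) ≡ ⟦ reduce g ⟧ (ι z)
  ⟦reduce-++⟧ g s {a} sa≡z = trans (cong (λ r → ⟦ r ⟧ (ι a)) (reduce-++ g s))
                                   (⟦⟧-joined (pushAll-joined (reduce-eval s sa≡z) g))

lemma3p1 : (D : Set) (_≤_ : Rel D 0ℓ) (_+_ : Op₂ D) (0# : D)
           (n : ℕ) (dX : Fin n → Fin n → D) → IsGeneralMetric _≡_ _≡_ _≤_ 0# _+_ dX →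
           (a₀ : Fin n) (P : PMap n → Bool) →
           (∀ p → T (P p) → IsPartialIsometry dX p × NotInIdentity p) →
           (∀ p → T (P p) → ∃ λ q → T (P q) × IsInverse p q) →
           (∀ x → x ≢ a₀ → ∃ λ (p : Gen P) → lookup (proj₁ p) a₀ ≡ just x) →
           (Y : Set) (dY : Y → Y → D) → IsGeneralMetric _≡_ _≡_ _≤_ 0# _+_ dY →
           (ι : Fin n → Y) → (∀ x x' → dY (ι x) (ι x') ≡ dX x x') →
           (φ : Gen P → Y → Y) →
           (∀ p y y' → dY (φ p y) (φ p y') ≡ dY y y') →
           (∀ p y → ∃ λ z → φ p z ≡ y) →
           (∀ p x y → lookup (proj₁ p) x ≡ just y → φ p (ι x) ≡ ι y) →
           Σ (Word P → Y) λ π →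
             (∀ g g' → SameCoset P a₀ g g' → π g ≡ π g') ×
             (∀ g (p q : Maybe (Gen P)) x y → apply P p a₀ ≡ just x → apply P q a₀ ≡ just y →
                ¬ SameCoset P a₀ (_·_ P g p) (_·_ P g q) →
                dY (π (_·_ P g p)) (π (_·_ P g q)) ≡ dX x y)
lemma3p1 D _≤_ _+_ 0# n dX _ a₀ P _ _ _ Y dY _ ι ι-isometry φ φ-isometry _ φ-extends =
  π , π-coset , π-edge
  where
    open FreeReduction P
    open WordAction φ
    open ExtensionAction P ι φ φ-extends

    π : Word P → Y
    π g = ⟦ reduce g ⟧ (ι a₀)

    π-coset : ∀ g g' → SameCoset P a₀ g g' → π g ≡ π g'
    π-coset g g' (h , (w , w≈h , wa₀≡a₀) , g'≈gh) = begin
      ⟦ reduce g ⟧ (ι a₀)        ≡⟨ ⟦reduce-++⟧ g w wa₀≡a₀ ⟨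
      ⟦ reduce (g ++ w) ⟧ (ι a₀) ≡⟨ cong (λ r → ⟦ r ⟧ (ι a₀)) (reduce-++-congʳ g w≈h) ⟩
      ⟦ reduce (g ++ h) ⟧ (ι a₀) ≡⟨ cong (λ r → ⟦ r ⟧ (ι a₀)) (≈F⇒reduce≡ g'≈gh) ⟨
      ⟦ reduce g' ⟧ (ι a₀)       ∎
      where open ≡-Reasoning

    π-· : ∀ g m {x} → apply P m a₀ ≡ just x → π (_·_ P g m) ≡ ⟦ reduce g ⟧ (ι x)
    π-· g nothing  refl  = refl
    π-· g (just p) pa₀≡x = ⟦reduce-++⟧ g (p ∷ []) pa₀≡x

    π-edge : ∀ g (p q : Maybe (Gen P)) x y → apply P p a₀ ≡ just x → apply P q a₀ ≡ just y →
             ¬ SameCoset P a₀ (_·_ P g p) (_·_ P g q) → dY (π (_·_ P g p)) (π (_·_ P g q)) ≡ dX x y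
    π-edge g p q x y pa₀≡x qa₀≡y _ = begin
      dY (π (_·_ P g p)) (π (_·_ P g q))           ≡⟨ cong₂ dY (π-· g p pa₀≡x) (π-· g q qa₀≡y) ⟩
      dY (⟦ reduce g ⟧ (ι x)) (⟦ reduce g ⟧ (ι y)) ≡⟨ ⟦⟧-isometry dY φ-isometry (reduce g) (ι x) (ι y) ⟩
      dY (ι x) (ι y)                               ≡⟨ ι-isometry x y ⟩
      dX x y                                       ∎
      where open ≡-Reasoning
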